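{- Let $\omega\in S_n$ and $1\le i<j\le n$ with $c_i(\omega),c_j(\omega)>0$, and let $a\in[c_i(\omega)]$, $b\in[c_j(\omega)]$. (1) If $m_{i,a}(\omega)>m_{j,b}(\omega)$ and $a,b\ge 2$, then $m_{i,a-1}(\omega)>m_{j,b-1}(\omega)$. (2) If $m_{i,a}(\omega)>m_{j,b}(\omega)$ with $a<c_i(\omega)$ and $b<c_j(\omega)$, then $m_{i,a+1}(\omega)>m_{j,b+1}(\omega)$.
   Context: Permutations are in one-line notation. ${\rm Inv}(\omega)=\{(i,j): 1\le i<j\le n,\ \omega(i)>\omega(j)\}$; $c_i(\omega)=\#\{j>i: \omega(i)>\omega(j)\}$; for $i<j$, $c_{i,j}(\omega)=\#\{k: i<k<j,\ \omega(i)>\omega(k)\}$; $[m]=\{1,\dots,m\}$. For $c_i(\omega)>0$ and $x\in[c_i(\omega)]$, $m_{i,x}(\omega)\in\mathbb{N}^n$ has $j$-th coordinate: $0$ if $(i,j)\in{\rm Inv}(\omega)$; $0$ if $j<i$; $x$ if $j=i$; $\max\{0,x-c_{i,j}(\omega)\}$ if $j>i$ and $(i,j)\notin{\rm Inv}(\omega)$. The order $>$ is the strict componentwise (product) order on $\mathbb{N}^n$. -}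

module Defs where

open import Data.Nat using (ℕ; zero; suc; _∸_; _≤_; _<_)
open import Data.Fin using (Fin; _<?_; _≟_)
import Data.Fin as F
open import Data.Fin.Permutation using (Permutation′; _⟨$⟩ʳ_)
open import Data.List using (List; length; filter)
open import Data.List.Base using ()
open import Data.Fin.Base using ()
open import Data.List using (allFin)
open import Data.Product using (_×_; ∃)
open import Relation.Nullary using (yes; no)
open import Relation.Nullary.Decidable using (_×-dec_)

-- Positions 1..n are represented by Fin n (0-based); ω(i) is ω ⟨$⟩ʳ i.

Inv : ∀ {n} → Permutation′ n → Fin n → Fin n → Set
Inv ω i j = (i F.< j) × ((ω ⟨$⟩ʳ j) F.< (ω ⟨$⟩ʳ i))

c : ∀ {n} → Permutation′ n → Fin n → ℕ
c {n} ω i = length (filter (λ j → (i <? j) ×-dec ((ω ⟨$⟩ʳ j) <? (ω ⟨$⟩ʳ i))) (allFin n))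

cc : ∀ {n} → Permutation′ n → Fin n → Fin n → ℕ
cc {n} ω i j = length (filter (λ k → ((i <? k) ×-dec (k <? j)) ×-dec ((ω ⟨$⟩ʳ k) <? (ω ⟨$⟩ʳ i))) (allFin n))

m : ∀ {n} → Permutation′ n → Fin n → ℕ → Fin n → ℕ
m ω i x j with j <? i
... | yes _ = 0
... | no _ with j ≟ i
...   | yes _ = x
...   | no _ with (ω ⟨$⟩ʳ j) <? (ω ⟨$⟩ʳ i)
...     | yes _ = 0
...     | no _ = x ∸ cc ω i j

_≻_ : ∀ {n} → (Fin n → ℕ) → (Fin n → ℕ) → Set
u ≻ v = (∀ j → v j ≤ u j) × ∃ (λ j → v j < u j)

-- Decreasing both indices lowers every coordinate of m by one, which preserves the
-- componentwise order. For increasing them, the j-th coordinate of m_{i,a} ≥ m_{j,b}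
-- forces ω(i) < ω(j) and c_{i,j} + b ≤ a; then every k > j not inverted by j is not
-- inverted by i either, and c_{i,k} ≤ c_{i,j} + c_{j,k} bounds the new coordinates.
-- In both cases coordinate i (where m_{j,·} vanishes) witnesses strictness.
module Submission where

open import Defs
open import Data.Nat using (ℕ; suc; _∸_; _≤_; _<_; _+_; z≤n; s≤s)
open import Data.Nat.Properties hiding (_<?_; _≟_)
open import Data.Fin using (Fin; _<?_; _≟_)
import Data.Fin as F
import Data.Fin.Properties as FP
open import Data.Fin.Permutation using (Permutation′; _⟨$⟩ʳ_)
open import Data.Product using (_×_; _,_)
open import Data.Sum using (_⊎_; inj₁; inj₂)
open import Data.List using ([]; _∷_; length; filter; allFin)
open import Data.List.Properties using (filter-accept)
open import Relation.Nullary using (yes; no; ¬_; contradiction)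
open import Relation.Unary using (Pred; Decidable)
open import Relation.Binary using (tri<; tri≈; tri>)
open import Relation.Binary.PropositionalEquality using (_≡_; refl; sym; cong; subst; subst₂; module ≡-Reasoning)
open import Level using (Level)

length-filter-≤-∷ : ∀ {a p} {A : Set a} {P : Pred A p} (P? : Decidable P) x xs
                  → length (filter P? xs) ≤ length (filter P? (x ∷ xs))
length-filter-≤-∷ P? x xs with P? x
... | yes _ = n≤1+n _
... | no _  = ≤-refl

module _ {a p q r : Level} {A : Set a} {P : Pred A p} {Q : Pred A q} {R : Pred A r}
         (P? : Decidable P) (Q? : Decidable Q) (R? : Decidable R) where

  length-filter-≤-+ : (∀ x → P x → Q x ⊎ R x) → ∀ xs
                    → length (filter P? xs) ≤ length (filter Q? xs) + length (filter R? xs)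
  length-filter-≤-+ P⊆Q∪R [] = z≤n
  length-filter-≤-+ P⊆Q∪R (x ∷ xs) with P? x
  ... | no _ = ≤-trans ih (+-mono-≤ (length-filter-≤-∷ Q? x xs) (length-filter-≤-∷ R? x xs))
    where ih = length-filter-≤-+ P⊆Q∪R xs
  ... | yes px with P⊆Q∪R x px
  ...   | inj₁ qx rewrite filter-accept Q? {xs = xs} qx =
          s≤s (≤-trans ih (+-monoʳ-≤ _ (length-filter-≤-∷ R? x xs)))
    where ih = length-filter-≤-+ P⊆Q∪R xs
  ...   | inj₂ rx rewrite filter-accept R? {xs = xs} rx =
          ≤-trans (s≤s (≤-trans ih (+-monoˡ-≤ _ (length-filter-≤-∷ Q? x xs))))
                  (≤-reflexive (sym (+-suc _ _)))
    where ih = length-filter-≤-+ P⊆Q∪R xs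

∸-comm : ∀ x y z → x ∸ y ∸ z ≡ x ∸ z ∸ y
∸-comm x y z = begin
  x ∸ y ∸ z   ≡⟨ ∸-+-assoc x y z ⟩
  x ∸ (y + z) ≡⟨ cong (x ∸_) (+-comm y z) ⟩
  x ∸ (z + y) ≡⟨ sym (∸-+-assoc x z y) ⟩
  x ∸ z ∸ y   ∎
  where open ≡-Reasoning

suc∸-mono : ∀ {x y} g e f → g + y ≤ x → f ≤ g + e → suc y ∸ e ≤ suc x ∸ f
suc∸-mono {x} {y} g e f g+y≤x f≤g+e = begin
  suc y ∸ e             ≡⟨ sym ([m+n]∸[m+o]≡n∸o g (suc y) e) ⟩
  (g + suc y) ∸ (g + e) ≤⟨ ∸-mono (≤-trans (≤-reflexive (+-suc g y)) (s≤s g+y≤x)) f≤g+e ⟩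
  suc x ∸ f             ∎
  where open ≤-Reasoning

infix 4 _≼_
_≼_ : ∀ {n} → (Fin n → ℕ) → (Fin n → ℕ) → Set
v ≼ u = ∀ k → v k ≤ u k

module _ {n : ℕ} (ω : Permutation′ n) where

  m-before : ∀ {i k} x → k F.< i → m ω i x k ≡ 0
  m-before {i} {k} x k<i with k <? i
  ... | yes _ = refl
  ... | no k≮i = contradiction k<i k≮i

  m-self : ∀ i x → m ω i x i ≡ x
  m-self i x with i <? i
  ... | yes i<i = contradiction i<i (<-irrefl refl)
  ... | no _ with i ≟ i
  ...   | yes _ = refl
  ...   | no i≢i = contradiction refl i≢i

  m-inversion : ∀ {i k} x → i F.< k → (ω ⟨$⟩ʳ k) F.< (ω ⟨$⟩ʳ i) → m ω i x k ≡ 0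
  m-inversion {i} {k} x i<k inv with k <? i
  ... | yes k<i = contradiction k<i (<-asym i<k)
  ... | no _ with k ≟ i
  ...   | yes refl = contradiction i<k (<-irrefl refl)
  ...   | no _ with (ω ⟨$⟩ʳ k) <? (ω ⟨$⟩ʳ i)
  ...     | yes _ = refl
  ...     | no ¬inv = contradiction inv ¬inv

  m-nonInversion : ∀ {i k} x → i F.< k → ¬ ((ω ⟨$⟩ʳ k) F.< (ω ⟨$⟩ʳ i))
                 → m ω i x k ≡ x ∸ cc ω i k
  m-nonInversion {i} {k} x i<k ¬inv with k <? i
  ... | yes k<i = contradiction k<i (<-asym i<k)
  ... | no _ with k ≟ i
  ...   | yes refl = contradiction i<k (<-irrefl refl)
  ...   | no _ with (ω ⟨$⟩ʳ k) <? (ω ⟨$⟩ʳ i)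
  ...     | yes inv = contradiction inv ¬inv
  ...     | no _ = refl

  m-∸ : ∀ i x d k → m ω i (x ∸ d) k ≡ m ω i x k ∸ d
  m-∸ i x d k with k <? i
  ... | yes _ = sym (0∸n≡0 d)
  ... | no _ with k ≟ i
  ...   | yes _ = refl
  ...   | no _ with (ω ⟨$⟩ʳ k) <? (ω ⟨$⟩ʳ i)
  ...     | yes _ = sym (0∸n≡0 d)
  ...     | no _ = ∸-comm x d (cc ω i k)

  -- Each k counted by c_{i,k} lies before j (counted by c_{i,j}) or after j, and then
  -- ω(k) < ω(i) ≤ ω(j) (counted by c_{j,k}).
  cc-≤-+ : ∀ {i j k} → ¬ ((ω ⟨$⟩ʳ j) F.< (ω ⟨$⟩ʳ i)) → cc ω i k ≤ cc ω i j + cc ω j k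
  cc-≤-+ {i} {j} {k} ¬inv = length-filter-≤-+ _ _ _ split (allFin n)
    where
    split : ∀ l → ((i F.< l) × (l F.< k)) × ((ω ⟨$⟩ʳ l) F.< (ω ⟨$⟩ʳ i))
          → (((i F.< l) × (l F.< j)) × ((ω ⟨$⟩ʳ l) F.< (ω ⟨$⟩ʳ i)))
          ⊎ (((j F.< l) × (l F.< k)) × ((ω ⟨$⟩ʳ l) F.< (ω ⟨$⟩ʳ j)))
    split l ((i<l , l<k) , l-inv) with FP.<-cmp l j
    ... | tri< l<j _ _ = inj₁ ((i<l , l<j) , l-inv)
    ... | tri≈ _ refl _ = contradiction l-inv ¬inv
    ... | tri> _ _ j<l = inj₂ ((j<l , l<k) , <-≤-trans l-inv (≮⇒≥ ¬inv))

  ≼-∸ : ∀ {i j x y} d → m ω j y ≼ m ω i x → m ω j (y ∸ d) ≼ m ω i (x ∸ d)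
  ≼-∸ {i} {j} {x} {y} d le k =
    subst₂ _≤_ (sym (m-∸ j y d k)) (sym (m-∸ i x d k)) (∸-monoˡ-≤ d (le k))

  module _ {i j : Fin n} (i<j : i F.< j) where

    ≼⇒≻ : ∀ {x y} → 0 < x → m ω j y ≼ m ω i x → m ω i x ≻ m ω j y
    ≼⇒≻ {x} {y} 0<x le = le , i , subst₂ _<_ (sym (m-before y i<j)) (sym (m-self i x)) 0<x

    ≼⇒¬inversion : ∀ {x y} → 0 < y → m ω j y ≼ m ω i x → ¬ ((ω ⟨$⟩ʳ j) F.< (ω ⟨$⟩ʳ i))
    ≼⇒¬inversion {x} {y} 0<y le inv =
      <-irrefl refl (≤-trans 0<y (subst₂ _≤_ (m-self j y) (m-inversion x i<j inv) (le j)))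

    ≼⇒cc+y≤x : ∀ {x y} → 0 < y → m ω j y ≼ m ω i x → cc ω i j + y ≤ x
    ≼⇒cc+y≤x {x} {y} 0<y le =
      subst (_≤ x) (+-comm y (cc ω i j)) (m≤o∸n⇒m+n≤o y (<⇒≤ cc<x) y≤x∸cc)
      where
      y≤x∸cc : y ≤ x ∸ cc ω i j
      y≤x∸cc = subst₂ _≤_ (m-self j y) (m-nonInversion x i<j (≼⇒¬inversion 0<y le)) (le j)
      cc<x : cc ω i j < x
      cc<x = m∸n≢0⇒n<m (m>n⇒m∸n≢0 (≤-trans 0<y y≤x∸cc))

    ≼-suc-of-¬inversion : ∀ {x y} → ¬ ((ω ⟨$⟩ʳ j) F.< (ω ⟨$⟩ʳ i)) → cc ω i j + y ≤ x
                        → m ω j (suc y) ≼ m ω i (suc x)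
    ≼-suc-of-¬inversion {x} {y} ¬inv cc+y≤x k with FP.<-cmp k j
    ... | tri< k<j _ _ = subst (_≤ _) (sym (m-before (suc y) k<j)) z≤n
    ... | tri≈ _ refl _ =
      subst₂ _≤_ (sym (m-self j (suc y))) (sym (m-nonInversion (suc x) i<j ¬inv))
             (suc∸-mono (cc ω i j) 0 (cc ω i j) cc+y≤x (m≤m+n _ 0))
    ... | tri> _ _ j<k with (ω ⟨$⟩ʳ k) <? (ω ⟨$⟩ʳ j)
    ...   | yes inv = subst (_≤ _) (sym (m-inversion (suc y) j<k inv)) z≤n
    ...   | no ¬inv-jk =
      subst₂ _≤_ (sym (m-nonInversion (suc y) j<k ¬inv-jk))
                 (sym (m-nonInversion (suc x) (<-trans i<j j<k)
                         (λ inv-ik → ¬inv-jk (<-≤-trans inv-ik (≮⇒≥ ¬inv)))))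
                 (suc∸-mono (cc ω i j) (cc ω j k) (cc ω i k) cc+y≤x (cc-≤-+ ¬inv))

    ≼-suc : ∀ {x y} → 0 < y → m ω j y ≼ m ω i x → m ω j (suc y) ≼ m ω i (suc x)
    ≼-suc 0<y le = ≼-suc-of-¬inversion (≼⇒¬inversion 0<y le) (≼⇒cc+y≤x 0<y le)

mainTheorem3 : ∀ (n : ℕ) (ω : Permutation′ n) (i j : Fin n) → i F.< j
    → 0 < c ω i → 0 < c ω j
    → (a b : ℕ) → 1 ≤ a → a ≤ c ω i → 1 ≤ b → b ≤ c ω j
    → ((m ω i a ≻ m ω j b) → 2 ≤ a → 2 ≤ b → m ω i (a ∸ 1) ≻ m ω j (b ∸ 1))
    × ((m ω i a ≻ m ω j b) → a < c ω i → b < c ω j → m ω i (suc a) ≻ m ω j (suc b))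
mainTheorem3 n ω i j i<j _ _ a b _ _ 1≤b _ =
  (λ { (le , _) 2≤a _ → ≼⇒≻ ω i<j (∸-monoˡ-≤ 1 2≤a) (≼-∸ ω {i} {j} {a} {b} 1 le) }) ,
  (λ { (le , _) _ _ → ≼⇒≻ ω i<j (s≤s z≤n) (≼-suc ω i<j 1≤b le) })
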